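{- Let $T$ be a tree on at least three vertices and $S\subseteq V(T)$. For a leaf $\ell\in S$, say that $S$ satisfies condition (II) for $\ell$ if every edge $\{a,b\}$ of $T$ with $a$ closer to $\ell$ than $b$ satisfies: (i) if $a,b\notin S$ then $N(b)\cap S=\emptyset$; (ii) if $a\notin S$, $b\in S$ then $|N(b)\cap S|\le 1$; (iii) if $a\in S$, $b\notin S$ then $|(N(b)\cap S)\setminus\{a\}|=1$; (iv) if $a,b\in S$ then $|(N(b)\cap S)\setminus\{a\}|=0$. If $S$ satisfies condition (II) for some leaf $\ell'\in S$, then $S$ also satisfies condition (II) for every other leaf $\ell''\in S$.
   Context: $N(b)$ denotes the set of neighbors of $b$; a leaf is a vertex of degree one; distances are graph distances in $T$. -}

module Defs where

open import Data.Nat using (ℕ; zero; suc; _<_; _≤_)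
open import Data.Fin using (Fin)
open import Data.Fin.Subset using (Subset; _∈_; _∉_; _∩_; _-_; ∣_∣; Empty)
open import Data.List using (List; []; _∷_; length; last)
open import Data.Empty using (⊥)
open import Data.List.Relation.Unary.Unique.Propositional using (Unique)
open import Data.List.Relation.Unary.Linked using (Linked)
open import Data.Maybe using (just)
open import Data.Product using (Σ; _×_; ∃)
open import Relation.Nullary using (¬_)
open import Relation.Binary.PropositionalEquality using (_≡_)

Graph : ℕ → Set
Graph n = Fin n → Subset n

module _ {n : ℕ} (G : Graph n) where

  Adj : Fin n → Fin n → Set
  Adj u v = v ∈ G u

  IsSimple : Set
  IsSimple = (∀ u v → Adj u v → Adj v u) × (∀ v → ¬ Adj v v)

  data Walk : Fin n → Fin n → ℕ → Set where
    here : ∀ {u} → Walk u u zero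
    step : ∀ {u w v k} → Adj u w → Walk w v k → Walk u v (suc k)

  Connected : Set
  Connected = ∀ u v → ∃ λ k → Walk u v k

  IsCycle : List (Fin n) → Set
  IsCycle [] = ⊥
  IsCycle (v ∷ vs) =
    (2 ≤ length vs) × Unique (v ∷ vs) × Linked Adj (v ∷ vs)
      × (∀ w → last (v ∷ vs) ≡ just w → Adj w v)

  Acyclic : Set
  Acyclic = ∀ vs → ¬ IsCycle vs

  IsTree : Set
  IsTree = IsSimple × Connected × Acyclic

  IsDist : Fin n → Fin n → ℕ → Set
  IsDist u v d = Walk u v d × (∀ k → Walk u v k → d ≤ k)

  Closer : Fin n → Fin n → Fin n → Set
  Closer ℓ a b = Σ ℕ λ da → Σ ℕ λ db → IsDist ℓ a da × IsDist ℓ b db × da < db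

  IsLeaf : Fin n → Set
  IsLeaf v = ∣ G v ∣ ≡ 1

  CondII : Subset n → Fin n → Set
  CondII S ℓ = ∀ a b → Adj a b → Closer ℓ a b →
      (a ∉ S → b ∉ S → Empty (G b ∩ S))
    × (a ∉ S → b ∈ S → ∣ G b ∩ S ∣ ≤ 1)
    × (a ∈ S → b ∉ S → ∣ (G b ∩ S) - a ∣ ≡ 1)
    × (a ∈ S → b ∈ S → ∣ (G b ∩ S) - a ∣ ≡ 0)

{-# OPTIONS --safe #-}
module Submission where

-- Root T at ℓ′ and at ℓ″.  Adjacent vertices have different depths, and every vertex other than
-- the root has exactly one neighbour of smaller depth, its parent.  Let ab be an edge with a closer
-- to ℓ″.  If a is also closer to ℓ′, (II) for ℓ′ applies verbatim.  Otherwise b = ℓ′, which is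
-- settled by ℓ′ being a leaf in S, or b has a parent p ≠ a towards ℓ′, and (II) at the edge pb
-- pins down N(b) ∩ S well enough to give (II) at ab, unless a, b ∉ S.  That case cannot occur: the
-- parent a′ of a towards ℓ″ lies outside S by clause (i) at ba, and by uniqueness of parents a′a
-- is again such an edge, so the descent from a towards ℓ″ would never reach ℓ″ ∈ S.

open import Data.Empty using (⊥; ⊥-elim)
open import Data.Fin using (Fin; _≟_)
open import Data.Fin.Properties using (any?)
open import Data.Fin.Subset using (Subset; _∈_; _∉_; _∩_; _-_; ∣_∣; Empty; inside; outside)
open import Data.Fin.Subset.Properties
  using (_∈?_; p─⊥≡p; x∈p∩q⁺; ∣p∩q∣≤∣p∣; x∈p∧x≢y⇒x∈p-y)
open import Data.List using (List; []; _∷_; _∷ʳ_; last; length)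
open import Data.List.Properties using (length-++)
open import Data.List.Relation.Unary.All as All using (All; []; _∷_)
import Data.List.Relation.Unary.All.Properties as All
open import Data.List.Relation.Unary.AllPairs using ([]; _∷_)
import Data.List.Relation.Unary.AllPairs.Properties as AllPairs
open import Data.List.Relation.Unary.Linked using (Linked; [-]; _∷_)
import Data.List.Relation.Unary.Linked.Properties as Linked
open import Data.List.Relation.Unary.Unique.Propositional using (Unique)
open import Data.Maybe using (Maybe; just)
open import Data.Maybe.Properties using (just-injective)
import Data.Maybe.Relation.Binary.Connected as Maybe
open import Data.Nat using (ℕ; zero; suc; _≤_; _<_; z≤n; s≤s; s≤s⁻¹)
open import Data.Nat.Induction using (<-wellFounded)
open import Data.Nat.Properties
  using (≤-refl; ≤-reflexive; ≤-trans; ≤-antisym; <-irrefl; <-asym; <-cmp; 1+n≢0; n≤0⇒n≡0;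
         m≤n+m; m≤n⇒m≤1+n; suc-injective)
open import Data.Product using (∃; _×_; _,_; proj₁; proj₂; uncurry)
open import Data.Sum using (_⊎_; inj₁; inj₂)
open import Data.Vec using (_∷_; here; there)
open import Induction.WellFounded using (Acc; acc)
open import Relation.Binary.Definitions using (tri<; tri≈; tri>)
open import Relation.Binary.PropositionalEquality
  using (_≡_; _≢_; refl; sym; trans; cong; subst; subst₂; ≢-sym)
open import Relation.Nullary using (Dec; yes; no; ¬_; contradiction)
open import Relation.Nullary.Decidable using (map′; _×-dec_)
open import Relation.Unary using (Decidable)

open import Defs

Least : (ℕ → Set) → ℕ → Set
Least P d = P d × (∀ k → P k → d ≤ k)

least : {P : ℕ → Set} → Decidable P → ∀ m → P m → ∃ (Least P)
least P? zero p = zero , p , λ _ _ → z≤n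
least P? (suc m) p with P? zero
... | yes p₀ = zero , p₀ , λ _ _ → z≤n
... | no ¬p₀ with least (λ k → P? (suc k)) m p
... | d , pd , d-min = suc d , pd , λ { zero p₀ → contradiction p₀ ¬p₀ ; (suc k) pk → s≤s (d-min k pk) }

Least-unique : {P : ℕ → Set} → ∀ {d e} → Least P d → Least P e → d ≡ e
Least-unique (pd , d-min) (pe , e-min) = ≤-antisym (d-min _ pe) (e-min _ pd)

last-∷ʳ : {A : Set} (xs : List A) (x : A) → last (xs ∷ʳ x) ≡ just x
last-∷ʳ [] x = refl
last-∷ʳ (y ∷ []) x = refl
last-∷ʳ (y ∷ z ∷ zs) x = last-∷ʳ (z ∷ zs) x

private
  variable
    m : ℕ
    x y : Fin m
    p : Subset m

x∈p⇒suc∣p-x∣≡∣p∣ : x ∈ p → suc ∣ p - x ∣ ≡ ∣ p ∣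
x∈p⇒suc∣p-x∣≡∣p∣ {p = inside ∷ p} here = cong (λ q → suc ∣ q ∣) (p─⊥≡p p)
x∈p⇒suc∣p-x∣≡∣p∣ {p = inside ∷ p} (there x∈p) = cong suc (x∈p⇒suc∣p-x∣≡∣p∣ x∈p)
x∈p⇒suc∣p-x∣≡∣p∣ {p = outside ∷ p} (there x∈p) = x∈p⇒suc∣p-x∣≡∣p∣ x∈p

∣p-x∣≡∣p-y∣ : x ∈ p → y ∈ p → ∣ p - x ∣ ≡ ∣ p - y ∣
∣p-x∣≡∣p-y∣ x∈p y∈p = suc-injective (trans (x∈p⇒suc∣p-x∣≡∣p∣ x∈p) (sym (x∈p⇒suc∣p-x∣≡∣p∣ y∈p)))

x∈p∧∣p∣≤1⇒∣p-x∣≡0 : x ∈ p → ∣ p ∣ ≤ 1 → ∣ p - x ∣ ≡ 0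
x∈p∧∣p∣≤1⇒∣p-x∣≡0 x∈p ∣p∣≤1 = n≤0⇒n≡0 (s≤s⁻¹ (subst (_≤ 1) (sym (x∈p⇒suc∣p-x∣≡∣p∣ x∈p)) ∣p∣≤1))

x∈p∧∣p-x∣≡0⇒∣p∣≤1 : x ∈ p → ∣ p - x ∣ ≡ 0 → ∣ p ∣ ≤ 1
x∈p∧∣p-x∣≡0⇒∣p∣≤1 x∈p ∣p-x∣≡0 = subst (_≤ 1) (x∈p⇒suc∣p-x∣≡∣p∣ x∈p) (s≤s (≤-reflexive ∣p-x∣≡0))

module _ {n : ℕ} (G : Graph n) where

  walk-snoc : ∀ {u v w k} → Walk G u v k → Adj G v w → Walk G u w (suc k)
  walk-snoc here v~w = step v~w here
  walk-snoc (step u~x x⇝v) v~w = step u~x (walk-snoc x⇝v v~w)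

  walk-unsnoc : ∀ {u v k} → Walk G u v (suc k) → ∃ λ p → Walk G u p k × Adj G p v
  walk-unsnoc (step u~v here) = _ , here , u~v
  walk-unsnoc (step u~x x⇝v@(step _ _)) with walk-unsnoc x⇝v
  ... | p , x⇝p , p~v = p , step u~x x⇝p , p~v

  walk-zero⇒≡ : ∀ {u v} → Walk G u v zero → u ≡ v
  walk-zero⇒≡ here = refl

  walk? : ∀ u v k → Dec (Walk G u v k)
  walk? u v zero = map′ (λ { refl → here }) walk-zero⇒≡ (u ≟ v)
  walk? u v (suc k) =
    map′ (λ (w , u~w , w⇝v) → step u~w w⇝v) (λ { (step u~w w⇝v) → _ , u~w , w⇝v })
         (any? λ w → (w ∈? G u) ×-dec walk? w v k)

  last-adj : ∀ {m : Maybe (Fin n)} {v w} → m ≡ just w → Adj G w v → ∀ x → m ≡ just x → Adj G x v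
  last-adj {v = v} ends w~v x ends′ = subst (λ y → Adj G y v) (just-injective (trans (sym ends) ends′)) w~v

module Tree {n : ℕ} {G : Graph n} (tree : IsTree G) where

  adj-sym : ∀ {u v} → Adj G u v → Adj G v u
  adj-sym = proj₁ (proj₁ tree) _ _

  adj-irrefl : ∀ {v} → ¬ Adj G v v
  adj-irrefl = proj₂ (proj₁ tree) _

  acyclic : Acyclic G
  acyclic = proj₂ (proj₂ tree)

  module Rooted (r : Fin n) where

    shortest : ∀ v → ∃ (Least (Walk G r v))
    shortest v = uncurry (least (walk? G r v)) (proj₁ (proj₂ tree) r v)

    depth : Fin n → ℕ
    depth v = proj₁ (shortest v)

    depth-isDist : ∀ v → IsDist G r v (depth v)
    depth-isDist v = proj₂ (shortest v)

    closer⇒depth< : ∀ {a b} → Closer G r a b → depth a < depth b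
    closer⇒depth< (_ , _ , a-dist , b-dist , da<db) =
      subst₂ _<_ (Least-unique a-dist (depth-isDist _)) (Least-unique b-dist (depth-isDist _)) da<db

    depth<⇒closer : ∀ {a b} → depth a < depth b → Closer G r a b
    depth<⇒closer a<b = _ , _ , depth-isDist _ , depth-isDist _ , a<b

    depth≡0⇒root : ∀ {v} → depth v ≡ 0 → r ≡ v
    depth≡0⇒root {v} v↓ = walk-zero⇒≡ G (subst (Walk G r v) v↓ (proj₁ (depth-isDist v)))

    depth-adj≤ : ∀ {u v} → Adj G u v → depth v ≤ suc (depth u)
    depth-adj≤ {u} u~v = proj₂ (depth-isDist _) _ (walk-snoc G (proj₁ (depth-isDist u)) u~v)

    lower-neighbour-depth : ∀ {v x} → Adj G v x → depth x < depth v → suc (depth x) ≡ depth v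
    lower-neighbour-depth v~x x<v = ≤-antisym x<v (depth-adj≤ (adj-sym v~x))

    parent : ∀ {v k} → depth v ≡ suc k → ∃ λ p → Adj G v p × depth p ≡ k
    parent {v} {k} v↓ with walk-unsnoc G (subst (Walk G r v) v↓ (proj₁ (depth-isDist v)))
    ... | p , r⇝p , p~v =
      p , adj-sym p~v , ≤-antisym (proj₂ (depth-isDist p) k r⇝p) (s≤s⁻¹ (subst (_≤ _) v↓ (depth-adj≤ p~v)))

    root-or-parent : ∀ v → r ≡ v ⊎ ∃ λ p → Adj G v p × depth p < depth v
    root-or-parent v with depth v in v↓
    ... | zero = inj₁ (depth≡0⇒root v↓)
    ... | suc k with parent v↓
    ... | p , v~p , refl = inj₂ (p , v~p , ≤-refl)

    record LowPath (k : ℕ) (u w : Fin n) : Set where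
      field
        inner  : List (Fin n)
        ends   : last (u ∷ inner) ≡ just w
        linked : Linked (Adj G) (u ∷ inner)
        unique : Unique (u ∷ inner)
        low    : All (λ x → depth x ≤ k) (u ∷ inner)
        long   : u ≢ w → 2 ≤ length inner

    above⇒≢ : ∀ {v x k} → depth v ≡ suc k → depth x ≤ k → v ≢ x
    above⇒≢ v↓ x≤k refl = <-irrefl refl (subst (_≤ _) v↓ x≤k)

    trivialPath : ∀ {k u} → depth u ≡ k → LowPath k u u
    trivialPath u↓ = record
      { inner = [] ; ends = refl ; linked = [-] ; unique = [] ∷ []
      ; low = ≤-reflexive u↓ ∷ [] ; long = λ u≢u → contradiction refl u≢u }

    -- Join the two parents' path to u and w; it stays simple because u and w lie one level above it.
    lowPath : ∀ k {u w} → depth u ≡ k → depth w ≡ k → LowPath k u w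
    lowPath zero u↓ w↓ with trans (sym (depth≡0⇒root u↓)) (depth≡0⇒root w↓)
    ... | refl = trivialPath u↓
    lowPath (suc k) {u} {w} u↓ w↓ with u ≟ w
    ... | yes refl = trivialPath u↓
    ... | no u≢w with parent u↓ | parent w↓
    ... | pu , u~pu , pu↓ | pw , w~pw , pw↓ = extend (lowPath k pu↓ pw↓)
      where
      extend : LowPath k pu pw → LowPath (suc k) u w
      extend P = record
        { inner  = pu ∷ inner ∷ʳ w
        ; ends   = last-∷ʳ (pu ∷ inner) w
        ; linked = u~pu ∷ Linked.++⁺ linked
                     (subst (λ m → Maybe.Connected (Adj G) m (just w)) (sym ends) (Maybe.just (adj-sym w~pw))) [-]
        ; unique = All.∷ʳ⁺ (All.map (above⇒≢ u↓) low) u≢w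
                   ∷ AllPairs.++⁺ unique ([] ∷ []) (All.map (λ x≤k → ≢-sym (above⇒≢ w↓ x≤k) ∷ []) low)
        ; low    = ≤-reflexive u↓ ∷ All.∷ʳ⁺ (All.map m≤n⇒m≤1+n low) (≤-reflexive w↓)
        ; long   = λ _ → s≤s (subst (1 ≤_) (sym (length-++ inner)) (m≤n+m 1 (length inner)))
        }
        where open LowPath P

    adj⇒depth≢ : ∀ {u v} → Adj G u v → depth u ≢ depth v
    adj⇒depth≢ {u} {v} u~v u≡v = acyclic (u ∷ inner) (long u≢v , unique , linked , last-adj G ends (adj-sym u~v))
      where
      open LowPath (lowPath (depth u) refl (sym u≡v))
      u≢v : u ≢ v
      u≢v refl = adj-irrefl u~v

    adj⇒depth<⊎depth> : ∀ {u v} → Adj G u v → depth u < depth v ⊎ depth v < depth u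
    adj⇒depth<⊎depth> {u} {v} u~v with <-cmp (depth u) (depth v)
    ... | tri< u<v _ _ = inj₁ u<v
    ... | tri≈ _ u≡v _ = contradiction u≡v (adj⇒depth≢ u~v)
    ... | tri> _ _ v<u = inj₂ v<u

    lower-neighbour-unique : ∀ {v u w} → Adj G v u → Adj G v w → depth u < depth v → depth w < depth v → u ≡ w
    lower-neighbour-unique {v} {u} {w} v~u v~w u<v w<v with u ≟ w
    ... | yes u≡w = u≡w
    ... | no u≢w = ⊥-elim (acyclic (v ∷ u ∷ inner)
            (m≤n⇒m≤1+n (long u≢w) , All.map (above⇒≢ v↓) low ∷ unique , v~u ∷ linked , last-adj G ends (adj-sym v~w)))
      where
      v↓ : depth v ≡ suc (depth u)
      v↓ = sym (lower-neighbour-depth v~u u<v)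
      open LowPath (lowPath (depth u) refl (suc-injective (trans (lower-neighbour-depth v~w w<v) v↓)))

module _ {n : ℕ} (G : Graph n) (S : Subset n) where

  CondIIAt : Fin n → Fin n → Set
  CondIIAt a b = (a ∉ S → b ∉ S → Empty (G b ∩ S))
    × (a ∉ S → b ∈ S → ∣ G b ∩ S ∣ ≤ 1)
    × (a ∈ S → b ∉ S → ∣ (G b ∩ S) - a ∣ ≡ 1)
    × (a ∈ S → b ∈ S → ∣ (G b ∩ S) - a ∣ ≡ 0)

  condIIAt-leaf : ∀ {ℓ a} → IsLeaf G ℓ → ℓ ∈ S → Adj G ℓ a → CondIIAt a ℓ
  condIIAt-leaf {ℓ} leaf ℓ∈S ℓ~a =
    (λ _ ℓ∉S → contradiction ℓ∈S ℓ∉S) , (λ _ _ → N≤1) ,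
    (λ _ ℓ∉S → contradiction ℓ∈S ℓ∉S) , (λ a∈S _ → x∈p∧∣p∣≤1⇒∣p-x∣≡0 (x∈p∩q⁺ (ℓ~a , a∈S)) N≤1)
    where
    N≤1 : ∣ G ℓ ∩ S ∣ ≤ 1
    N≤1 = ≤-trans (∣p∩q∣≤∣p∣ (G ℓ) S) (≤-reflexive leaf)

  condIIAt-transfer : ∀ {a b p} → Adj G b a → Adj G b p → a ≢ p → (a ∉ S → b ∉ S → ⊥)
    → CondIIAt p b → CondIIAt a b
  condIIAt-transfer {a} {b} {p} b~a b~p a≢p not-both-outside (i , ii , iii , iv) =
    (λ a∉S b∉S → ⊥-elim (not-both-outside a∉S b∉S)) , ii′ , iii′ , iv′
    where
    a∈N : a ∈ S → a ∈ G b ∩ S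
    a∈N a∈S = x∈p∩q⁺ (b~a , a∈S)

    p∈N : p ∈ S → p ∈ G b ∩ S
    p∈N p∈S = x∈p∩q⁺ (b~p , p∈S)

    ii′ : a ∉ S → b ∈ S → ∣ G b ∩ S ∣ ≤ 1
    ii′ _ b∈S with p ∈? S
    ... | yes p∈S = x∈p∧∣p-x∣≡0⇒∣p∣≤1 (p∈N p∈S) (iv p∈S b∈S)
    ... | no p∉S = ii p∉S b∈S

    iii′ : a ∈ S → b ∉ S → ∣ (G b ∩ S) - a ∣ ≡ 1
    iii′ a∈S b∉S with p ∈? S
    ... | yes p∈S = trans (∣p-x∣≡∣p-y∣ (a∈N a∈S) (p∈N p∈S)) (iii p∈S b∉S)
    ... | no p∉S = ⊥-elim (i p∉S b∉S (a , a∈N a∈S))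

    iv′ : a ∈ S → b ∈ S → ∣ (G b ∩ S) - a ∣ ≡ 0
    iv′ a∈S b∈S with p ∈? S
    ... | yes p∈S = ⊥-elim (1+n≢0 (trans (x∈p⇒suc∣p-x∣≡∣p∣ (x∈p∧x≢y⇒x∈p-y (a∈N a∈S) a≢p)) (iv p∈S b∈S)))
    ... | no p∉S = x∈p∧∣p∣≤1⇒∣p-x∣≡0 (a∈N a∈S) (ii p∉S b∈S)

module _ {n : ℕ} {G : Graph n} (tree : IsTree G) {S : Subset n} {ℓ₁ ℓ₂ : Fin n}
         (ℓ₁∈S : ℓ₁ ∈ S) (cond₁ : CondII G S ℓ₁) (ℓ₂∈S : ℓ₂ ∈ S) where

  open Tree tree
  module D₁ = Rooted ℓ₁
  module D₂ = Rooted ℓ₂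

  no-edge-outside : ∀ {a b} → Acc _<_ (D₂.depth a) → Adj G a b
    → D₂.depth a < D₂.depth b → D₁.depth b < D₁.depth a → a ∉ S → b ∉ S → ⊥
  no-edge-outside {a} {b} (acc rec) a~b a<₂b b<₁a a∉S b∉S with D₂.root-or-parent a
  ... | inj₁ refl = a∉S ℓ₂∈S
  ... | inj₂ (a′ , a~a′ , a′<₂a) with a′ ∈? S
  ... | yes a′∈S = proj₁ (cond₁ b a (adj-sym a~b) (D₁.depth<⇒closer b<₁a)) b∉S a∉S (a′ , x∈p∩q⁺ (a~a′ , a′∈S))
  ... | no a′∉S with D₁.adj⇒depth<⊎depth> a~a′
  ... | inj₁ a<₁a′ = no-edge-outside (rec a′<₂a) (adj-sym a~a′) a′<₂a a<₁a′ a′∉S a∉S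
  ... | inj₂ a′<₁a with D₁.lower-neighbour-unique a~b a~a′ b<₁a a′<₁a
  ... | refl = <-asym a<₂b a′<₂a

  condII-transfer : IsLeaf G ℓ₁ → CondII G S ℓ₂
  condII-transfer leaf a b a~b a◁₂b with D₁.adj⇒depth<⊎depth> a~b
  ... | inj₁ a<₁b = cond₁ a b a~b (D₁.depth<⇒closer a<₁b)
  ... | inj₂ b<₁a with D₁.root-or-parent b
  ... | inj₁ refl = condIIAt-leaf G S leaf ℓ₁∈S (adj-sym a~b)
  ... | inj₂ (p , b~p , p<₁b) =
    condIIAt-transfer G S (adj-sym a~b) b~p a≢p
      (no-edge-outside (<-wellFounded _) a~b (D₂.closer⇒depth< a◁₂b) b<₁a)
      (cond₁ p b (adj-sym b~p) (D₁.depth<⇒closer p<₁b))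
    where
    a≢p : a ≢ p
    a≢p refl = <-asym b<₁a p<₁b

lemma15 : (n : ℕ) → 3 ≤ n → (T : Graph n) → IsTree T → (S : Subset n)
    → (ℓ′ : Fin n) → IsLeaf T ℓ′ → ℓ′ ∈ S → CondII T S ℓ′
    → (ℓ″ : Fin n) → IsLeaf T ℓ″ → ℓ″ ∈ S → CondII T S ℓ″
lemma15 n _ T tree S ℓ′ ℓ′-leaf ℓ′∈S cond′ ℓ″ _ ℓ″∈S = condII-transfer tree ℓ′∈S cond′ ℓ″∈S ℓ′-leaf
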